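{- Let $M_1,M_2$ be binary matroids with $M=M_1\oplus M_2$ and $E(M_1)\cap E(M_2)=Z$. Let $X_1$ be independent in $M_1\setminus Z$ and let $X_2$ be independent in $M_2/Z$. Then $X_1\cup X_2$ is independent in $M$.
   Context: A cycle of a binary matroid is a disjoint union of circuits. For binary matroids $M_1,M_2$, $M_1\triangle M_2$ is the binary matroid on $E(M_1)\triangle E(M_2)$ whose cycles are exactly the sets $C_1\triangle C_2$ with $C_i$ a cycle of $M_i$. One writes $M=M_1\oplus M_2$ if $M=M_1\triangle M_2$ and either $E(M_1)\cap E(M_2)=\emptyset$, or $|E(M_1)\cap E(M_2)|=1$ where that single element is not a loop, or $E(M_1)\cap E(M_2)$ is a $3$-element set that is a circuit of both $M_1$ and $M_2$. $M_1\setminus Z$ denotes deletion and $M_2/Z$ contraction. -}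

module Defs where

open import Data.Nat using (ℕ; zero; suc)
open import Data.Bool using (Bool; true; false; if_then_else_; _xor_)
open import Data.Fin using (Fin)
import Data.Fin as F
open import Data.Fin.Subset public
  using (Subset; _∈_; _⊆_; _∩_; _∪_; _─_; ⊥; ⁅_⁆; ∣_∣; Nonempty)
open import Data.Vec using (Vec; []; _∷_; replicate; zipWith)
open import Data.List using (List; foldr)
open import Data.List.Relation.Unary.All using (All)
open import Data.List.Relation.Unary.AllPairs using (AllPairs)
open import Data.Product using (Σ; _×_; ∃)
open import Data.Sum using (_⊎_)
open import Relation.Binary.PropositionalEquality using (_≡_; _≢_)
open import Relation.Nullary using (¬_)
open import Function.Bundles using (_⇔_)

_△_ : ∀ {n} → Subset n → Subset n → Subset n
_△_ = zipWith _xor_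

Disjoint : ∀ {n} → Subset n → Subset n → Set
Disjoint A B = A ∩ B ≡ ⊥

-- A matroid on the ground set `ground`, given by its circuits
-- (circuit axioms (C1)-(C3) of Oxley, plus circuits lie in the ground set).
record Matroid (n : ℕ) : Set₁ where
  field
    ground    : Subset n
    IsCircuit : Subset n → Set
    circuit⊆  : ∀ C → IsCircuit C → C ⊆ ground
    C1        : ¬ IsCircuit ⊥
    C2        : ∀ C D → IsCircuit C → IsCircuit D → C ⊆ D → C ≡ D
    C3        : ∀ C D (e : Fin n) → IsCircuit C → IsCircuit D → C ≢ D →
                e ∈ C → e ∈ D →
                ∃ λ C' → IsCircuit C' × C' ⊆ ((C ∪ D) ─ ⁅ e ⁆)

open Matroid public

Independent : ∀ {n} → Matroid n → Subset n → Set
Independent M X = X ⊆ ground M × (∀ C → IsCircuit M C → ¬ (C ⊆ X))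

IsCycle : ∀ {n} → Matroid n → Subset n → Set
IsCycle {n} M C =
  Σ (List (Subset n)) λ Cs →
    All (IsCircuit M) Cs × AllPairs Disjoint Cs × C ≡ foldr _∪_ ⊥ Cs

IsLoop : ∀ {n} → Matroid n → Fin n → Set
IsLoop M e = IsCircuit M ⁅ e ⁆

sumCols : ∀ {n m} → (Fin n → Vec Bool m) → Subset n → Vec Bool m
sumCols {zero}  {m} A []      = replicate m false
sumCols {suc n} {m} A (b ∷ Y) =
  zipWith _xor_ (if b then A F.zero else replicate m false)
                (sumCols (λ i → A (F.suc i)) Y)

LinIndep : ∀ {n m} → (Fin n → Vec Bool m) → Subset n → Set
LinIndep {n} {m} A X = ∀ Y → Y ⊆ X → sumCols A Y ≡ replicate m false → Y ≡ ⊥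

Binary : ∀ {n} → Matroid n → Set
Binary {n} M = Σ ℕ λ m → Σ (Fin n → Vec Bool m) λ A →
  ∀ X → X ⊆ ground M → (Independent M X ⇔ LinIndep A X)

Minimal : ∀ {n} → (Subset n → Set) → Subset n → Set
Minimal P X = P X × (∀ Y → P Y → Y ⊆ X → Y ≡ X)

CircuitDel : ∀ {n} → Matroid n → Subset n → Subset n → Set
CircuitDel M Z C = IsCircuit M C × Disjoint C Z

CircuitCon : ∀ {n} → Matroid n → Subset n → Subset n → Set
CircuitCon M Z = Minimal (λ D → Nonempty D × ∃ λ C → IsCircuit M C × D ≡ C ─ Z)

IndepDel : ∀ {n} → Matroid n → Subset n → Subset n → Set
IndepDel M Z X = X ⊆ (ground M ─ Z) × (∀ C → CircuitDel M Z C → ¬ (C ⊆ X))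

IndepCon : ∀ {n} → Matroid n → Subset n → Subset n → Set
IndepCon M Z X = X ⊆ (ground M ─ Z) × (∀ C → CircuitCon M Z C → ¬ (C ⊆ X))

IsDelta : ∀ {n} → Matroid n → Matroid n → Matroid n → Set
IsDelta M M₁ M₂ =
  ground M ≡ ground M₁ △ ground M₂ ×
  (∀ C → IsCycle M C ⇔ (∃ λ C₁ → ∃ λ C₂ → IsCycle M₁ C₁ × IsCycle M₂ C₂ × C ≡ C₁ △ C₂))

IsOplus : ∀ {n} → Matroid n → Matroid n → Matroid n → Set
IsOplus M M₁ M₂ =
  IsDelta M M₁ M₂ ×
  ( Disjoint (ground M₁) (ground M₂)
  ⊎ (∃ λ e → ground M₁ ∩ ground M₂ ≡ ⁅ e ⁆ × ¬ IsLoop M₁ e × ¬ IsLoop M₂ e)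
  ⊎ (∣ ground M₁ ∩ ground M₂ ∣ ≡ 3 ×
     IsCircuit M₁ (ground M₁ ∩ ground M₂) × IsCircuit M₂ (ground M₁ ∩ ground M₂)))

{-# OPTIONS --safe #-}
module Submission where

-- Let C be a circuit of M inside X₁ ∪ X₂, and write C = C₁ △ C₂ with Cᵢ a cycle of Mᵢ; C avoids
-- Z = E(M₁) ∩ E(M₂). If C₂ left Z, a circuit D of M₂ through such an element would satisfy
-- D ─ Z ⊆ X₂, contradicting independence of X₂ in M₂ / Z. So C₂ ⊆ Z, and the shape of a
-- 1-, 2- or 3-sum forces C₂ to be ∅ or the triangle Z, a cycle of M₁ either way. Then C ⊆ X₁ is
-- independent in M₁, while in a GF(2)-representation of M₁ the columns of C = C₁ △ C₂ sum to 0;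
-- hence C = ∅, which is not a circuit.

open import Defs
open import Algebra.Bundles using (CommutativeRing)
open import Data.Bool using (Bool; true; false; _xor_; if_then_else_)
import Data.Bool as Bool
open import Data.Bool.Properties
  using (xor-identityˡ; xor-identityʳ; xor-same; xor-∧-commutativeRing)
open import Data.Empty using (⊥-elim)
open import Data.Fin using (Fin)
import Data.Fin as Fin
open import Data.Fin.Subset using (_∉_; _⊂_; ⋃)
open import Data.Fin.Subset.Induction using (Acc; acc; ⊂-wellFounded)
open import Data.Fin.Subset.Properties
  using ( ∉⊥; x∈⁅y⁆⇒x≡y; ⊆-refl; ⊆-trans; ⊆-antisym; nonempty?; Empty-unique; _∈?_
        ; x∈p∩q⁺; x∈p∩q⁻; p∩q⊆p; ∩-zeroʳ; ∩-distribˡ-∪; ∪-identityʳ; x∈p∪q⁻; x∈p∪q⁺; p⊆p∪q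
        ; x∈p∧x∉q⇒x∈p─q; p─q⊆p)
open import Data.List using ([]; _∷_)
open import Data.List.Relation.Unary.All using (All; []; _∷_)
open import Data.List.Relation.Unary.AllPairs using (AllPairs; []; _∷_)
open import Data.Nat using (ℕ; zero; suc)
open import Data.Product using (∃; _×_; _,_; proj₁; proj₂)
open import Data.Sum using (_⊎_; inj₁; inj₂; [_,_]′)
open import Data.Vec using (Vec; []; _∷_; here; there; replicate; zipWith)
open import Data.Vec.Properties using (zipWith-identityˡ; zipWith-identityʳ; ∷-injectiveʳ; ≡-dec)
open import Function.Bundles using (_⇔_; Equivalence)
open import Relation.Binary.PropositionalEquality
open import Relation.Nullary using (¬_; yes; no)

open import Algebra.Properties.CommutativeSemigroup
  (CommutativeRing.+-commutativeSemigroup xor-∧-commutativeRing)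
  using () renaming (interchange to xor-interchange)

private
  variable
    n : ℕ
    x : Fin n
    p q C D X Y Z : Subset n

x∈p─q⇒x∉q : x ∈ p ─ q → x ∉ q
x∈p─q⇒x∉q {p = _ ∷ _} {true ∷ _} () here
x∈p─q⇒x∉q {p = _ ∷ p} {_ ∷ q} (there x∈p─q) (there x∈q) = x∈p─q⇒x∉q {p = p} x∈p─q x∈q

x∈p△q⁻ : x ∈ p △ q → x ∈ p ⊎ x ∈ q
x∈p△q⁻ {p = true ∷ _}  {false ∷ _} here = inj₁ here
x∈p△q⁻ {p = false ∷ _} {true ∷ _}  here = inj₂ here
x∈p△q⁻ {p = _ ∷ p} {_ ∷ q} (there x∈p△q) with x∈p△q⁻ {p = p} x∈p△q
... | inj₁ x∈p = inj₁ (there x∈p)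
... | inj₂ x∈q = inj₂ (there x∈q)

x∈p△q⁺ˡ : x ∈ p → x ∉ q → x ∈ p △ q
x∈p△q⁺ˡ {q = true ∷ _}  here x∉q = ⊥-elim (x∉q here)
x∈p△q⁺ˡ {q = false ∷ _} here _   = here
x∈p△q⁺ˡ {q = _ ∷ _} (there x∈p) x∉q = there (x∈p△q⁺ˡ x∈p (λ x∈q → x∉q (there x∈q)))

x∈p△q⁺ʳ : x ∉ p → x ∈ q → x ∈ p △ q
x∈p△q⁺ʳ {p = true ∷ _}  x∉p here = ⊥-elim (x∉p here)
x∈p△q⁺ʳ {p = false ∷ _} _   here = here
x∈p△q⁺ʳ {p = _ ∷ _} x∉p (there x∈q) = there (x∈p△q⁺ʳ (λ x∈p → x∉p (there x∈p)) x∈q)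

disjoint⇒∪≡△ : Disjoint p q → p ∪ q ≡ p △ q
disjoint⇒∪≡△ {p = []}        {[]}        _ = refl
disjoint⇒∪≡△ {p = true ∷ p}  {false ∷ q} d = cong (true ∷_) (disjoint⇒∪≡△ (∷-injectiveʳ d))
disjoint⇒∪≡△ {p = false ∷ p} {_ ∷ q}     d = cong (_ ∷_) (disjoint⇒∪≡△ (∷-injectiveʳ d))
disjoint⇒∪≡△ {p = true ∷ p}  {true ∷ q}  ()

disjoint-⋃ : ∀ {ps} → All (Disjoint p) ps → Disjoint p (⋃ ps)
disjoint-⋃ {p = p} [] = ∩-zeroʳ p
disjoint-⋃ {p = p} {q ∷ qs} (p∩q≡⊥ ∷ ds) = begin
  p ∩ (q ∪ ⋃ qs)        ≡⟨ ∩-distribˡ-∪ p q (⋃ qs) ⟩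
  p ∩ q ∪ p ∩ ⋃ qs      ≡⟨ cong₂ _∪_ p∩q≡⊥ (disjoint-⋃ ds) ⟩
  ⊥ ∪ ⊥                 ≡⟨ ∪-identityʳ ⊥ ⟩
  ⊥                     ∎
  where open ≡-Reasoning

∈⋃⁻ : ∀ {P : Subset n → Set} {ps} → All P ps → x ∈ ⋃ ps →
      ∃ λ p → P p × x ∈ p × p ⊆ ⋃ ps
∈⋃⁻ [] x∈⊥ = ⊥-elim (∉⊥ x∈⊥)
∈⋃⁻ {ps = p ∷ ps} (Pp ∷ Pps) x∈p∪⋃ps with x∈p∪q⁻ p (⋃ ps) x∈p∪⋃ps
... | inj₁ x∈p = p , Pp , x∈p , p⊆p∪q (⋃ ps)
... | inj₂ x∈⋃ps with ∈⋃⁻ Pps x∈⋃ps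
...   | q , Pq , x∈q , q⊆⋃ps = q , Pq , x∈q , λ y∈q → x∈p∪q⁺ (inj₂ (q⊆⋃ps y∈q))

⊆∧≢⇒⊂ : p ⊆ q → p ≢ q → p ⊂ q
⊆∧≢⇒⊂ {p = p} {q} p⊆q p≢q with nonempty? (q ─ p)
... | yes (x , x∈q─p) = p⊆q , x , p─q⊆p q p x∈q─p , x∈p─q⇒x∉q {p = q} x∈q─p
... | no q─p-empty = ⊥-elim (p≢q (⊆-antisym p⊆q q⊆p))
  where
  q⊆p : q ⊆ p
  q⊆p {x} x∈q with x ∈? p
  ... | yes x∈p = x∈p
  ... | no x∉p = ⊥-elim (q─p-empty (x , x∈p∧x∉q⇒x∈p─q x∈q x∉p))

nonempty⊆⁅x⁆⇒≡⁅x⁆ : Nonempty p → p ⊆ ⁅ x ⁆ → p ≡ ⁅ x ⁆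
nonempty⊆⁅x⁆⇒≡⁅x⁆ {p = p} {x = x} (y , y∈p) p⊆⁅x⁆ = ⊆-antisym p⊆⁅x⁆ ⁅x⁆⊆p
  where
  ⁅x⁆⊆p : ⁅ x ⁆ ⊆ p
  ⁅x⁆⊆p z∈⁅x⁆ =
    subst (_∈ p) (trans (x∈⁅y⁆⇒x≡y x (p⊆⁅x⁆ y∈p)) (sym (x∈⁅y⁆⇒x≡y x z∈⁅x⁆))) y∈p

-- Stated negatively because P need not be decidable, so no minimal P-set can be exhibited.
noMinimal⇒noneBelow : ∀ {P : Subset n → Set} {X} →
  (∀ Y → Minimal P Y → ¬ (Y ⊆ X)) → ∀ Y → P Y → ¬ (Y ⊆ X)
noMinimal⇒noneBelow {P = P} {X = X} noMinimal Y = go Y (⊂-wellFounded Y)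
  where
  go : ∀ Y → Acc _⊂_ Y → P Y → ¬ (Y ⊆ X)
  go Y (acc below) PY Y⊆X = noMinimal Y (PY , minimal) Y⊆X
    where
    minimal : ∀ W → P W → W ⊆ Y → W ≡ Y
    minimal W PW W⊆Y with ≡-dec Bool._≟_ W Y
    ... | yes W≡Y = W≡Y
    ... | no W≢Y = ⊥-elim (go W (below (⊆∧≢⇒⊂ W⊆Y W≢Y)) PW (⊆-trans W⊆Y Y⊆X))

infixl 6 _⊕_

_⊕_ : ∀ {m} → Vec Bool m → Vec Bool m → Vec Bool m
_⊕_ = zipWith _xor_

0ᵛ : ∀ {m} → Vec Bool m
0ᵛ = replicate _ false

⊕-identityˡ : ∀ {m} (u : Vec Bool m) → 0ᵛ ⊕ u ≡ u
⊕-identityˡ = zipWith-identityˡ xor-identityˡ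

⊕-identityʳ : ∀ {m} (u : Vec Bool m) → u ⊕ 0ᵛ ≡ u
⊕-identityʳ = zipWith-identityʳ xor-identityʳ

⊕-self : ∀ {m} (u : Vec Bool m) → u ⊕ u ≡ 0ᵛ
⊕-self []      = refl
⊕-self (b ∷ u) = cong₂ _∷_ (xor-same b) (⊕-self u)

⊕-interchange : ∀ {m} (u v w z : Vec Bool m) → (u ⊕ v) ⊕ (w ⊕ z) ≡ (u ⊕ w) ⊕ (v ⊕ z)
⊕-interchange []       []       []       []       = refl
⊕-interchange (a ∷ u) (b ∷ v) (c ∷ w) (d ∷ z) =
  cong₂ _∷_ (xor-interchange a b c d) (⊕-interchange u v w z)

if-xor : ∀ {m} b c (u : Vec Bool m) →
         (if b xor c then u else 0ᵛ) ≡ (if b then u else 0ᵛ) ⊕ (if c then u else 0ᵛ)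
if-xor true  true  u = sym (⊕-self u)
if-xor true  false u = sym (⊕-identityʳ u)
if-xor false c     u = sym (⊕-identityˡ _)

sumCols-⊥ : ∀ {m} (A : Fin n → Vec Bool m) → sumCols A ⊥ ≡ 0ᵛ
sumCols-⊥ {zero}  A = refl
sumCols-⊥ {suc n} A = trans (⊕-identityˡ _) (sumCols-⊥ (λ i → A (Fin.suc i)))

sumCols-△ : ∀ {m} (A : Fin n → Vec Bool m) (X Y : Subset n) →
            sumCols A (X △ Y) ≡ sumCols A X ⊕ sumCols A Y
sumCols-△ {zero}  A [] [] = sym (⊕-identityˡ _)
sumCols-△ {suc n} A (b ∷ X) (c ∷ Y) =
  trans (cong₂ _⊕_ (if-xor b c (A Fin.zero)) (sumCols-△ (λ i → A (Fin.suc i)) X Y))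
        (⊕-interchange _ _ _ _)

sumCols-△-zero : ∀ {m} (A : Fin n → Vec Bool m) {X Y : Subset n} →
  sumCols A X ≡ 0ᵛ → sumCols A Y ≡ 0ᵛ → sumCols A (X △ Y) ≡ 0ᵛ
sumCols-△-zero A {X} {Y} X≡0 Y≡0 = begin
  sumCols A (X △ Y)           ≡⟨ sumCols-△ A X Y ⟩
  sumCols A X ⊕ sumCols A Y   ≡⟨ cong₂ _⊕_ X≡0 Y≡0 ⟩
  0ᵛ ⊕ 0ᵛ                     ≡⟨ ⊕-identityˡ 0ᵛ ⟩
  0ᵛ                          ∎
  where open ≡-Reasoning

circuit-nonempty : (M : Matroid n) → IsCircuit M C → Nonempty C
circuit-nonempty {C = C} M C-circ with nonempty? C
... | yes C-nonempty = C-nonempty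
... | no C-empty = ⊥-elim (C1 M (subst (IsCircuit M) (Empty-unique C-empty) C-circ))

circuit⇒cycle : (M : Matroid n) → IsCircuit M C → IsCycle M C
circuit⇒cycle {C = C} M C-circ = C ∷ [] , C-circ ∷ [] , [] ∷ [] , sym (∪-identityʳ C)

∈cycle⇒∈circuit : (M : Matroid n) → IsCycle M C → x ∈ C →
                  ∃ λ D → IsCircuit M D × x ∈ D × D ⊆ C
∈cycle⇒∈circuit M (_ , circs , _ , refl) = ∈⋃⁻ circs

cycle⊆ground : (M : Matroid n) → IsCycle M C → C ⊆ ground M
cycle⊆ground M C-cycle x∈C with ∈cycle⇒∈circuit M C-cycle x∈C
... | D , D-circ , x∈D , _ = circuit⊆ M D D-circ x∈D

independent-⊆ : (M : Matroid n) → Independent M X → Y ⊆ X → Independent M Y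
independent-⊆ M (X⊆E , noCircuit) Y⊆X =
  ⊆-trans Y⊆X X⊆E , λ C C-circ C⊆Y → noCircuit C C-circ (⊆-trans C⊆Y Y⊆X)

⊂circuit⇒independent : (M : Matroid n) → IsCircuit M C → Y ⊆ C → Y ≢ C → Independent M Y
⊂circuit⇒independent M C-circ Y⊆C Y≢C =
  ⊆-trans Y⊆C (circuit⊆ M _ C-circ) ,
  λ D D-circ D⊆Y → Y≢C (⊆-antisym Y⊆C (subst (_⊆ _) (C2 M D _ D-circ C-circ (⊆-trans D⊆Y Y⊆C)) D⊆Y))

indepDel⇒independent : (M : Matroid n) → IndepDel M Z X → Independent M X
indepDel⇒independent {Z = Z} {X} M (X⊆E─Z , noCircuit) =
  (λ x∈X → p─q⊆p (ground M) Z (X⊆E─Z x∈X)) ,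
  λ C C-circ C⊆X → noCircuit C (C-circ , avoidsZ C⊆X) C⊆X
  where
  avoidsZ : ∀ {C} → C ⊆ X → Disjoint C Z
  avoidsZ {C} C⊆X = Empty-unique λ (x , x∈C∩Z) →
    let x∈C , x∈Z = x∈p∩q⁻ C Z x∈C∩Z in x∈p─q⇒x∉q {p = ground M} (X⊆E─Z (C⊆X x∈C)) x∈Z

Represents : ∀ {m} → Matroid n → (Fin n → Vec Bool m) → Set
Represents M A = ∀ X → X ⊆ ground M → (Independent M X ⇔ LinIndep A X)

circuit-sumCols≡0 : ∀ {m} (M : Matroid n) {A : Fin n → Vec Bool m} →
                    Represents M A → IsCircuit M C → sumCols A C ≡ 0ᵛ
circuit-sumCols≡0 {C = C} M {A} A-rep C-circ with ≡-dec Bool._≟_ (sumCols A C) 0ᵛ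
... | yes C≡0 = C≡0
... | no C≢0 = ⊥-elim (proj₂ (Equivalence.from (A-rep C C⊆E) C-linIndep) C C-circ ⊆-refl)
  where
  C⊆E : C ⊆ ground M
  C⊆E = circuit⊆ M C C-circ
  C-linIndep : LinIndep A C
  C-linIndep Y Y⊆C Y≡0 =
    Equivalence.to (A-rep Y (⊆-trans Y⊆C C⊆E))
      (⊂circuit⇒independent M C-circ Y⊆C λ { refl → C≢0 Y≡0 }) Y ⊆-refl Y≡0

cycle-sumCols≡0 : ∀ {m} (M : Matroid n) {A : Fin n → Vec Bool m} →
                  Represents M A → IsCycle M C → sumCols A C ≡ 0ᵛ
cycle-sumCols≡0 M {A} A-rep (Cs , circs , disjoint , refl) = go Cs circs disjoint
  where
  go : ∀ Cs → All (IsCircuit M) Cs → AllPairs Disjoint Cs → sumCols A (⋃ Cs) ≡ 0ᵛ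
  go []       []            []             = sumCols-⊥ A
  go (D ∷ Ds) (D-circ ∷ cs) (D-disj ∷ ds) =
    trans (cong (sumCols A) (disjoint⇒∪≡△ (disjoint-⋃ D-disj)))
          (sumCols-△-zero A (circuit-sumCols≡0 M A-rep D-circ) (go Ds cs ds))

indepCon⇒trace⊈ : (M : Matroid n) → IndepCon M Z X → IsCircuit M D →
                  Nonempty (D ─ Z) → ¬ (D ─ Z ⊆ X)
indepCon⇒trace⊈ {D = D} M (_ , noCircuit) D-circ nonempty =
  noMinimal⇒noneBelow noCircuit _ (nonempty , D , D-circ , refl)

sharedCycle₂⇒cycle₁ : ∀ {M M₁ M₂ : Matroid n} → IsOplus M M₁ M₂ →
  IsCycle M₂ C → C ⊆ ground M₁ ∩ ground M₂ → IsCycle M₁ C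
sharedCycle₂⇒cycle₁ _ ([] , _ , _ , refl) _ = [] , [] , [] , refl
sharedCycle₂⇒cycle₁ {M₂ = M₂} (_ , inj₁ E₁∩E₂≡⊥) ((D ∷ _) , (D-circ ∷ _) , _ , refl) C⊆E₁∩E₂ =
  let x , x∈D = circuit-nonempty M₂ D-circ
  in ⊥-elim (∉⊥ (subst (x ∈_) E₁∩E₂≡⊥ (C⊆E₁∩E₂ (x∈p∪q⁺ (inj₁ x∈D)))))
sharedCycle₂⇒cycle₁ {M₂ = M₂} (_ , inj₂ (inj₁ (e , E₁∩E₂≡⁅e⁆ , _ , e-nonloop₂)))
                    ((D ∷ _) , (D-circ ∷ _) , _ , refl) C⊆E₁∩E₂ =
  ⊥-elim (e-nonloop₂ (subst (IsCircuit M₂) D≡⁅e⁆ D-circ))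
  where
  D≡⁅e⁆ : D ≡ ⁅ e ⁆
  D≡⁅e⁆ = nonempty⊆⁅x⁆⇒≡⁅x⁆ (circuit-nonempty M₂ D-circ)
            (λ x∈D → subst (_ ∈_) E₁∩E₂≡⁅e⁆ (C⊆E₁∩E₂ (x∈p∪q⁺ (inj₁ x∈D))))
sharedCycle₂⇒cycle₁ {M₁ = M₁} {M₂} (_ , inj₂ (inj₂ (_ , S-circ₁ , S-circ₂)))
                    ((D ∷ Ds) , (D-circ ∷ _) , _ , refl) C⊆S =
  circuit⇒cycle M₁ (subst (IsCircuit M₁) S≡C S-circ₁)
  where
  D⊆C : D ⊆ D ∪ ⋃ Ds
  D⊆C = p⊆p∪q (⋃ Ds)
  D≡S : D ≡ ground M₁ ∩ ground M₂
  D≡S = C2 M₂ D _ D-circ S-circ₂ (⊆-trans D⊆C C⊆S)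
  S≡C : ground M₁ ∩ ground M₂ ≡ D ∪ ⋃ Ds
  S≡C = ⊆-antisym (subst (_⊆ _) D≡S D⊆C) C⊆S

module DeletionContractionPair {M₁ M₂ : Matroid n} {X₁ X₂ : Subset n}
         (X₁-indep : IndepDel M₁ (ground M₁ ∩ ground M₂) X₁)
         (X₂-indep : IndepCon M₂ (ground M₁ ∩ ground M₂) X₂) where

  private
    E₁ E₂ : Subset n
    E₁ = ground M₁
    E₂ = ground M₂

  ∈X₂⇒∉E₁ : x ∈ X₂ → x ∉ E₁
  ∈X₂⇒∉E₁ {x = x} x∈X₂ x∈E₁ = x∈p─q⇒x∉q {p = E₂} x∈E₂─Z (x∈p∩q⁺ (x∈E₁ , p─q⊆p E₂ _ x∈E₂─Z))
    where
    x∈E₂─Z : x ∈ E₂ ─ E₁ ∩ E₂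
    x∈E₂─Z = proj₁ X₂-indep x∈X₂

  ∈X₁⇒∉E₂ : x ∈ X₁ → x ∉ E₂
  ∈X₁⇒∉E₂ {x = x} x∈X₁ x∈E₂ = x∈p─q⇒x∉q {p = E₁} x∈E₁─Z (x∈p∩q⁺ (p─q⊆p E₁ _ x∈E₁─Z , x∈E₂))
    where
    x∈E₁─Z : x ∈ E₁ ─ E₁ ∩ E₂
    x∈E₁─Z = proj₁ X₁-indep x∈X₁

  X₁∪X₂⊆E₁△E₂ : X₁ ∪ X₂ ⊆ E₁ △ E₂
  X₁∪X₂⊆E₁△E₂ x∈X with x∈p∪q⁻ X₁ X₂ x∈X
  ... | inj₁ x∈X₁ = x∈p△q⁺ˡ (p─q⊆p E₁ _ (proj₁ X₁-indep x∈X₁)) (∈X₁⇒∉E₂ x∈X₁)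
  ... | inj₂ x∈X₂ = x∈p△q⁺ʳ (∈X₂⇒∉E₁ x∈X₂) (p─q⊆p E₂ _ (proj₁ X₂-indep x∈X₂))

  ∈X₁∪X₂∩E₁⇒∈X₁ : x ∈ X₁ ∪ X₂ → x ∈ E₁ → x ∈ X₁
  ∈X₁∪X₂∩E₁⇒∈X₁ x∈X x∈E₁ with x∈p∪q⁻ X₁ X₂ x∈X
  ... | inj₁ x∈X₁ = x∈X₁
  ... | inj₂ x∈X₂ = ⊥-elim (∈X₂⇒∉E₁ x∈X₂ x∈E₁)

  ∈X₁∪X₂∩E₂⇒∈X₂ : x ∈ X₁ ∪ X₂ → x ∈ E₂ → x ∈ X₂
  ∈X₁∪X₂∩E₂⇒∈X₂ x∈X x∈E₂ with x∈p∪q⁻ X₁ X₂ x∈X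
  ... | inj₁ x∈X₁ = ⊥-elim (∈X₁⇒∉E₂ x∈X₁ x∈E₂)
  ... | inj₂ x∈X₂ = x∈X₂

  module SplitCycle {C₁ C₂ : Subset n} (C₁-cycle : IsCycle M₁ C₁) (C₂-cycle : IsCycle M₂ C₂)
           (C⊆X : C₁ △ C₂ ⊆ X₁ ∪ X₂) where

    C₂─E₁∩E₂⊆X₂ : C₂ ─ E₁ ∩ E₂ ⊆ X₂
    C₂─E₁∩E₂⊆X₂ {z} z∈C₂─Z = ∈X₁∪X₂∩E₂⇒∈X₂ (C⊆X (x∈p△q⁺ʳ z∉C₁ z∈C₂)) z∈E₂
      where
      z∈C₂ : z ∈ C₂
      z∈C₂ = p─q⊆p C₂ _ z∈C₂─Z
      z∈E₂ : z ∈ E₂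
      z∈E₂ = cycle⊆ground M₂ C₂-cycle z∈C₂
      z∉C₁ : z ∉ C₁
      z∉C₁ z∈C₁ = x∈p─q⇒x∉q {p = C₂} z∈C₂─Z (x∈p∩q⁺ (cycle⊆ground M₁ C₁-cycle z∈C₁ , z∈E₂))

    C₂⊆E₁∩E₂ : C₂ ⊆ E₁ ∩ E₂
    C₂⊆E₁∩E₂ {y} y∈C₂ with y ∈? E₁ ∩ E₂
    ... | yes y∈Z = y∈Z
    ... | no y∉Z with ∈cycle⇒∈circuit M₂ C₂-cycle y∈C₂
    ...   | D , D-circ , y∈D , D⊆C₂ =
      ⊥-elim (indepCon⇒trace⊈ M₂ X₂-indep D-circ (y , x∈p∧x∉q⇒x∈p─q y∈D y∉Z) D─Z⊆X₂)
      where
      D─Z⊆X₂ : D ─ E₁ ∩ E₂ ⊆ X₂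
      D─Z⊆X₂ z∈D─Z = C₂─E₁∩E₂⊆X₂
        (x∈p∧x∉q⇒x∈p─q (D⊆C₂ (p─q⊆p D _ z∈D─Z)) (x∈p─q⇒x∉q {p = D} z∈D─Z))

    C₁△C₂⊆X₁ : C₁ △ C₂ ⊆ X₁
    C₁△C₂⊆X₁ x∈C = ∈X₁∪X₂∩E₁⇒∈X₁ (C⊆X x∈C)
      ([ cycle⊆ground M₁ C₁-cycle , (λ x∈C₂ → p∩q⊆p E₁ E₂ (C₂⊆E₁∩E₂ x∈C₂)) ]′ (x∈p△q⁻ {p = C₁} x∈C))

lemma18 : ∀ {n} (M M₁ M₂ : Matroid n) → Binary M → Binary M₁ → Binary M₂ →
          IsOplus M M₁ M₂ → (Z : Subset n) → ground M₁ ∩ ground M₂ ≡ Z →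
          (X₁ X₂ : Subset n) → IndepDel M₁ Z X₁ → IndepCon M₂ Z X₂ →
          Independent M (X₁ ∪ X₂)
lemma18 M M₁ M₂ _ (_ , A , A-rep) _ oplus@((E≡E₁△E₂ , cycles) , _) _ refl X₁ X₂ X₁-indep X₂-indep =
  subst (X₁ ∪ X₂ ⊆_) (sym E≡E₁△E₂) X₁∪X₂⊆E₁△E₂ , noCircuit
  where
  open DeletionContractionPair {M₁ = M₁} {M₂} X₁-indep X₂-indep
  noCircuit : ∀ C → IsCircuit M C → ¬ (C ⊆ X₁ ∪ X₂)
  noCircuit C C-circ C⊆X with Equivalence.to (cycles C) (circuit⇒cycle M C-circ)
  ... | C₁ , C₂ , C₁-cycle , C₂-cycle , refl = C1 M (subst (IsCircuit M) C≡⊥ C-circ)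
    where
    open SplitCycle C₁-cycle C₂-cycle C⊆X
    C₂-cycle₁ : IsCycle M₁ C₂
    C₂-cycle₁ = sharedCycle₂⇒cycle₁ {M = M} {M₁} {M₂} oplus C₂-cycle C₂⊆E₁∩E₂
    C-indep₁ : Independent M₁ (C₁ △ C₂)
    C-indep₁ = independent-⊆ M₁ (indepDel⇒independent M₁ X₁-indep) C₁△C₂⊆X₁
    C-sum≡0 : sumCols A (C₁ △ C₂) ≡ 0ᵛ
    C-sum≡0 = sumCols-△-zero A {C₁} {C₂} (cycle-sumCols≡0 M₁ {A} A-rep C₁-cycle)
                                          (cycle-sumCols≡0 M₁ {A} A-rep C₂-cycle₁)
    C≡⊥ : C₁ △ C₂ ≡ ⊥
    C≡⊥ = Equivalence.to (A-rep _ (proj₁ C-indep₁)) C-indep₁ _ ⊆-refl C-sum≡0
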